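{- Let $\mathbf a=(a_i),\mathbf b=(b_i)\in\mathbb Z^k$ with $\mathbf a\preceq\mathbf b$, and let $e_t$, $e_{t,i}$, $f_{t,i}$, $c_{t,i}$ be defined by the construction below. Then for every $t\in[k]$: (i) $e_t=\sum_{i=1}^{t-1}e_{t,i}$; (ii) $\sum_{i=1}^t a_i=\sum_{i=1}^t c_{t,i}$.
   Context: $[k]=\{1,\dots,k\}$; $\mathbf a\preceq\mathbf b$ means $\sum_{i=1}^t a_i\le\sum_{i=1}^t b_i$ for all $t\in[k]$; $[x]_+=\max\{x,0\}$; an empty sum is $0$. Construction: for $t=1,\dots,k$ in turn, set $e_t=[a_t-b_t]_+$ and $f_{t,1}=e_t$; if $t\ge2$, for $i=1,\dots,t-1$ successively set $e_{t,i}=\min\{f_{t,i},\,b_i-c_{t-1,i}\}$, $f_{t,i+1}=f_{t,i}-e_{t,i}$, $c_{t,i}=c_{t-1,i}+e_{t,i}$; finally set $c_{t,t}=a_t-e_t$. (For $t=1$ only $e_1$, $f_{1,1}$ and $c_{1,1}=a_1-e_1$ are defined.) -}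

module Defs where

open import Data.Nat as ℕ using (ℕ; zero; suc; _∸_)
open import Data.Bool using (if_then_else_)
open import Data.Integer using (ℤ; 0ℤ; _+_; _-_; _⊓_; _⊔_)

-- Sequences are 1-indexed functions ℕ → ℤ; only indices 1..k are ever used.

[_]₊ : ℤ → ℤ
[ x ]₊ = x ⊔ 0ℤ

sumTo : (ℕ → ℤ) → ℕ → ℤ
sumTo f zero    = 0ℤ
sumTo f (suc n) = sumTo f n + f (suc n)

module Construction (a b : ℕ → ℤ) where

  e : ℕ → ℤ
  e t = [ a t - b t ]₊

  -- Given the previous row p = c_{t-1,·}, g p t n = f_{t,n+1}:
  -- f_{t,1} = e_t,  f_{t,i+1} = f_{t,i} - min{f_{t,i}, b_i - c_{t-1,i}}
  g : (ℕ → ℤ) → ℕ → ℕ → ℤ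
  g p t zero    = e t
  g p t (suc n) = g p t n - (g p t n ⊓ (b (suc n) - p (suc n)))

  eRow : (ℕ → ℤ) → ℕ → ℕ → ℤ
  eRow p t i = g p t (i ∸ 1) ⊓ (b i - p i)

  -- c t i = c_{t,i}  (for 1 ≤ i ≤ t; other entries are unused and set to 0)
  c : ℕ → ℕ → ℤ
  c zero    i = 0ℤ
  c (suc t) zero = 0ℤ
  c (suc t) (suc j) =
    if suc j ℕ.<ᵇ suc t then c t (suc j) + eRow (c t) (suc t) (suc j)
    else if suc j ℕ.≡ᵇ suc t then a (suc t) - e (suc t)
    else 0ℤ

  f : ℕ → ℕ → ℤ
  f t i = g (c (t ∸ 1)) t (i ∸ 1)

  eᵢ : ℕ → ℕ → ℤ
  eᵢ t i = f t i ⊓ (b i - c (t ∸ 1) i)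

_⪯[_]_ : (ℕ → ℤ) → ℕ → (ℕ → ℤ) → Set
a ⪯[ k ] b = ∀ t → 1 ℕ.≤ t → t ℕ.≤ k → sumTo a t Data.Integer.≤ sumTo b t

{-# OPTIONS --safe #-}
module Submission where

open import Defs
open import Data.Nat using (ℕ; _≤_; _∸_)
open import Data.Integer using (ℤ)
open import Data.Product using (_×_)
open import Relation.Binary.PropositionalEquality using (_≡_)

open import Algebra.Properties.CommutativeSemigroup using (interchange)
open import Data.Bool using (true; false)
open import Data.Empty using (⊥-elim)
open import Data.Integer using (0ℤ; _+_; _-_; -_; _⊓_; _⊔_)
import Data.Integer as ℤ
open import Data.Integer.Properties
open import Data.Integer.Tactic.RingSolver using (solve-∀)
open import Data.Nat using (zero; suc)
import Data.Nat as ℕ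
import Data.Nat.Properties as ℕ
open import Data.Product using (_,_)
open import Data.Sum using (inj₁; inj₂)
open import Relation.Binary.PropositionalEquality using (refl; sym; trans; cong; cong₂; subst; module ≡-Reasoning)

-- In row t the excess e_t is poured greedily into the gaps b_i − c_{t−1,i} ≥ 0 of the earlier
-- entries, so after i steps the unpoured remainder is f_{t,i+1} = [e_t − Σ_{j≤i} (b_j − c_{t−1,j})]₊.
-- By induction on t, row t−1 sums to Σ_{i<t} a_i, hence its total gap is Σ_{i<t} (b_i − a_i),
-- and majorization at t says that this is at least a_t − b_t (and at least 0), so at least e_t:
-- the excess is absorbed completely, which is (i). Then row t sums to
-- Σ_{i<t} a_i + e_t + (a_t − e_t), which is (ii).

[x+m]+[y-m]≡x+y : ∀ x m y → (x + m) + (y - m) ≡ x + y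
[x+m]+[y-m]≡x+y = solve-∀

x+u≤y+v⇒u-v≤y-x : ∀ x u y v → x + u ℤ.≤ y + v → u - v ℤ.≤ y - x
x+u≤y+v⇒u-v≤y-x x u y v x+u≤y+v =
  0≤i-j⇒j≤i (subst (0ℤ ℤ.≤_) (rearrange x u y v) (i≤j⇒0≤j-i x+u≤y+v))
  where
  rearrange : ∀ x u y v → (y + v) - (x + u) ≡ (y - x) - (u - v)
  rearrange = solve-∀

sumTo-cong : ∀ {f h : ℕ → ℤ} n → (∀ {i} → 1 ≤ i → i ≤ n → f i ≡ h i) → sumTo f n ≡ sumTo h n
sumTo-cong zero    f≗h = refl
sumTo-cong (suc n) f≗h =
  cong₂ _+_ (sumTo-cong n (λ 1≤i i≤n → f≗h 1≤i (ℕ.m≤n⇒m≤1+n i≤n))) (f≗h (ℕ.s≤s ℕ.z≤n) ℕ.≤-refl)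

sumTo-distrib-+ : ∀ (f h : ℕ → ℤ) n → sumTo (λ i → f i + h i) n ≡ sumTo f n + sumTo h n
sumTo-distrib-+ f h zero    = refl
sumTo-distrib-+ f h (suc n) = trans (cong (_+ (f (suc n) + h (suc n))) (sumTo-distrib-+ f h n))
  (interchange +-commutativeSemigroup (sumTo f n) (sumTo h n) (f (suc n)) (h (suc n)))

sumTo-distrib-- : ∀ (f h : ℕ → ℤ) n → sumTo (λ i → f i - h i) n ≡ sumTo f n - sumTo h n
sumTo-distrib-- f h n = begin
  sumTo (λ i → f i - h i) n         ≡⟨ sumTo-distrib-+ f (λ i → - h i) n ⟩
  sumTo f n + sumTo (λ i → - h i) n ≡⟨ cong (sumTo f n +_) (sumTo-neg n) ⟩
  sumTo f n - sumTo h n             ∎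
  where
  open ≡-Reasoning
  sumTo-neg : ∀ n → sumTo (λ i → - h i) n ≡ - sumTo h n
  sumTo-neg zero    = refl
  sumTo-neg (suc n) =
    trans (cong (_+ - h (suc n)) (sumTo-neg n)) (sym (neg-distrib-+ (sumTo h n) (h (suc n))))

i-i⊓j≡[i-j]₊ : ∀ i j → i - (i ⊓ j) ≡ [ i - j ]₊
i-i⊓j≡[i-j]₊ i j = begin
  i - (i ⊓ j)         ≡⟨ cong (i +_) (neg-distrib-⊓-⊔ i j) ⟩
  i + (- i ⊔ - j)     ≡⟨ mono-≤-distrib-⊔ (+-monoʳ-≤ i) (- i) (- j) ⟩
  (i - i) ⊔ (i - j)   ≡⟨ cong (_⊔ (i - j)) (+-inverseʳ i) ⟩
  0ℤ ⊔ (i - j)        ≡⟨ ⊔-comm 0ℤ (i - j) ⟩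
  [ i - j ]₊          ∎
  where open ≡-Reasoning

[[i]₊-j]₊≡[i-j]₊ : ∀ i {j} → 0ℤ ℤ.≤ j → [ [ i ]₊ - j ]₊ ≡ [ i - j ]₊
[[i]₊-j]₊≡[i-j]₊ i {j} 0≤j = begin
  ((i ⊔ 0ℤ) - j) ⊔ 0ℤ        ≡⟨ cong (_⊔ 0ℤ) (mono-≤-distrib-⊔ (+-monoˡ-≤ (- j)) i 0ℤ) ⟩
  ((i - j) ⊔ (0ℤ - j)) ⊔ 0ℤ  ≡⟨ cong (λ x → ((i - j) ⊔ x) ⊔ 0ℤ) (+-identityˡ (- j)) ⟩
  ((i - j) ⊔ - j) ⊔ 0ℤ       ≡⟨ ⊔-assoc (i - j) (- j) 0ℤ ⟩
  (i - j) ⊔ (- j ⊔ 0ℤ)       ≡⟨ cong ((i - j) ⊔_) (i≤j⇒i⊔j≡j (neg-mono-≤ 0≤j)) ⟩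
  [ i - j ]₊                 ∎
  where open ≡-Reasoning

module _ (a b : ℕ → ℤ) where
  open Construction a b

  c-below-diagonal : ∀ {t j} → j ℕ.< t → c (suc t) (suc j) ≡ c t (suc j) + eRow (c t) (suc t) (suc j)
  c-below-diagonal {t} {j} j<t with j ℕ.<ᵇ t | ℕ.<⇒<ᵇ j<t
  ... | true | _ = refl

  c-diagonal : ∀ t → c (suc t) (suc t) ≡ a (suc t) - e (suc t)
  c-diagonal t with t ℕ.<ᵇ t | ℕ.<ᵇ⇒< t t
  ... | true  | t<t = ⊥-elim (ℕ.<-irrefl refl (t<t _))
  ... | false | _ with t ℕ.≡ᵇ t | ℕ.≡⇒≡ᵇ t t refl
  ...   | true | _ = refl

  c≤b : ∀ {t i} → 1 ≤ i → i ≤ t → c t i ℤ.≤ b i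
  c≤b {suc t} {suc j} _ (ℕ.s≤s j≤t) with ℕ.m≤n⇒m<n∨m≡n j≤t
  ... | inj₁ j<t = begin
    c (suc t) (suc j)                        ≡⟨ c-below-diagonal j<t ⟩
    c t (suc j) + eRow (c t) (suc t) (suc j) ≤⟨ +-monoʳ-≤ (c t (suc j)) (i⊓j≤j _ _) ⟩
    c t (suc j) + (b (suc j) - c t (suc j))  ≡⟨ x+[y-x]≡y (c t (suc j)) (b (suc j)) ⟩
    b (suc j)                                ∎
    where
    open ≤-Reasoning
    x+[y-x]≡y : ∀ x y → x + (y - x) ≡ y
    x+[y-x]≡y = solve-∀
  ... | inj₂ refl = begin
    c (suc j) (suc j)                   ≡⟨ c-diagonal j ⟩
    a (suc j) - e (suc j)               ≤⟨ +-monoʳ-≤ (a (suc j)) (neg-mono-≤ (i≤i⊔j _ 0ℤ)) ⟩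
    a (suc j) - (a (suc j) - b (suc j)) ≡⟨ x-[x-y]≡y (a (suc j)) (b (suc j)) ⟩
    b (suc j)                           ∎
    where
    open ≤-Reasoning
    x-[x-y]≡y : ∀ x y → x - (x - y) ≡ y
    x-[x-y]≡y = solve-∀

  sumTo-eRow+g≡e : ∀ p t n → sumTo (eRow p t) n + g p t n ≡ e t
  sumTo-eRow+g≡e p t zero    = +-identityˡ (e t)
  sumTo-eRow+g≡e p t (suc n) =
    trans ([x+m]+[y-m]≡x+y (sumTo (eRow p t) n) (eRow p t (suc n)) (g p t n)) (sumTo-eRow+g≡e p t n)

  g≡[e-sumTo-gap]₊ : ∀ p t n → (∀ {i} → 1 ≤ i → i ≤ n → p i ℤ.≤ b i) →
                     g p t n ≡ [ e t - sumTo (λ i → b i - p i) n ]₊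
  g≡[e-sumTo-gap]₊ p t zero    _   = begin
    e t            ≡⟨ i≥j⇒i⊔j≡i (i≤j⊔i (a t - b t) 0ℤ) ⟨
    [ e t ]₊       ≡⟨ cong [_]₊ (+-identityʳ (e t)) ⟨
    [ e t - 0ℤ ]₊  ∎
    where open ≡-Reasoning
  g≡[e-sumTo-gap]₊ p t (suc n) p≤b = begin
    g p t n - (g p t n ⊓ gap (suc n))         ≡⟨ i-i⊓j≡[i-j]₊ (g p t n) (gap (suc n)) ⟩
    [ g p t n - gap (suc n) ]₊                ≡⟨ cong (λ x → [ x - gap (suc n) ]₊) induction-hypothesis ⟩
    [ [ e t - sumTo gap n ]₊ - gap (suc n) ]₊ ≡⟨ [[i]₊-j]₊≡[i-j]₊ (e t - sumTo gap n) 0≤gap ⟩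
    [ (e t - sumTo gap n) - gap (suc n) ]₊    ≡⟨ cong [_]₊ (x-y-z≡x-[y+z] (e t) (sumTo gap n) (gap (suc n))) ⟩
    [ e t - sumTo gap (suc n) ]₊              ∎
    where
    open ≡-Reasoning
    gap : ℕ → ℤ
    gap i = b i - p i
    induction-hypothesis : g p t n ≡ [ e t - sumTo gap n ]₊
    induction-hypothesis = g≡[e-sumTo-gap]₊ p t n (λ 1≤i i≤n → p≤b 1≤i (ℕ.m≤n⇒m≤1+n i≤n))
    0≤gap : 0ℤ ℤ.≤ gap (suc n)
    0≤gap = i≤j⇒0≤j-i (p≤b (ℕ.s≤s ℕ.z≤n) ℕ.≤-refl)
    x-y-z≡x-[y+z] : ∀ x y z → (x - y) - z ≡ x - (y + z)
    x-y-z≡x-[y+z] = solve-∀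

  module _ {k : ℕ} (a⪯b : a ⪯[ k ] b) where

    sumTo-a≤sumTo-b : ∀ {t} → t ≤ k → sumTo a t ℤ.≤ sumTo b t
    sumTo-a≤sumTo-b {zero}  _   = ≤-refl
    sumTo-a≤sumTo-b {suc t} t≤k = a⪯b (suc t) (ℕ.s≤s ℕ.z≤n) t≤k

    sumTo-eRow≡e : ∀ {t} → suc t ≤ k → sumTo (c t) t ≡ sumTo a t → sumTo (eRow (c t) (suc t)) t ≡ e (suc t)
    sumTo-eRow≡e {t} t<k row = begin
      sumTo (eRow (c t) (suc t)) t                     ≡⟨ +-identityʳ _ ⟨
      sumTo (eRow (c t) (suc t)) t + 0ℤ                ≡⟨ cong (sumTo (eRow (c t) (suc t)) t +_) remainder≡0 ⟨
      sumTo (eRow (c t) (suc t)) t + g (c t) (suc t) t ≡⟨ sumTo-eRow+g≡e (c t) (suc t) t ⟩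
      e (suc t)                                        ∎
      where
      open ≡-Reasoning
      sumTo-gap≡ : sumTo (λ i → b i - c t i) t ≡ sumTo b t - sumTo a t
      sumTo-gap≡ = trans (sumTo-distrib-- b (c t) t) (cong (λ x → sumTo b t - x) row)
      e≤sumTo-gap : e (suc t) ℤ.≤ sumTo (λ i → b i - c t i) t
      e≤sumTo-gap = subst (e (suc t) ℤ.≤_) (sym sumTo-gap≡)
        (⊔-lub (x+u≤y+v⇒u-v≤y-x (sumTo a t) (a (suc t)) (sumTo b t) (b (suc t))
                                  (a⪯b (suc t) (ℕ.s≤s ℕ.z≤n) t<k))
               (i≤j⇒0≤j-i (sumTo-a≤sumTo-b (ℕ.<⇒≤ t<k))))
      remainder≡0 : g (c t) (suc t) t ≡ 0ℤ
      remainder≡0 = trans (g≡[e-sumTo-gap]₊ (c t) (suc t) t c≤b) (i≤j⇒i⊔j≡j (i≤j⇒i-j≤0 e≤sumTo-gap))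

    sumTo-c≡sumTo-a : ∀ {t} → t ≤ k → sumTo (c t) t ≡ sumTo a t
    sumTo-c≡sumTo-a {zero}  _   = refl
    sumTo-c≡sumTo-a {suc t} t<k = begin
      sumTo (c (suc t)) t + c (suc t) (suc t)            ≡⟨ cong₂ _+_ off-diagonal (c-diagonal t) ⟩
      (sumTo a t + e (suc t)) + (a (suc t) - e (suc t))  ≡⟨ [x+m]+[y-m]≡x+y (sumTo a t) (e (suc t)) (a (suc t)) ⟩
      sumTo a t + a (suc t)                              ∎
      where
      open ≡-Reasoning
      row : sumTo (c t) t ≡ sumTo a t
      row = sumTo-c≡sumTo-a (ℕ.<⇒≤ t<k)
      off-diagonal : sumTo (c (suc t)) t ≡ sumTo a t + e (suc t)
      off-diagonal = begin
        sumTo (c (suc t)) t                          ≡⟨ sumTo-cong t (λ { {suc j} _ j<t → c-below-diagonal j<t }) ⟩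
        sumTo (λ i → c t i + eRow (c t) (suc t) i) t ≡⟨ sumTo-distrib-+ (c t) (eRow (c t) (suc t)) t ⟩
        sumTo (c t) t + sumTo (eRow (c t) (suc t)) t ≡⟨ cong₂ _+_ row (sumTo-eRow≡e t<k row) ⟩
        sumTo a t + e (suc t)                        ∎

lemma11 : (k : ℕ) (a b : ℕ → ℤ) → a ⪯[ k ] b →
    ∀ t → 1 ≤ t → t ≤ k →
      (Construction.e a b t ≡ sumTo (Construction.eᵢ a b t) (t ∸ 1))
      × (sumTo a t ≡ sumTo (Construction.c a b t) t)
lemma11 k a b a⪯b (suc t) _ t<k =
  sym (sumTo-eRow≡e a b a⪯b t<k (sumTo-c≡sumTo-a a b a⪯b (ℕ.<⇒≤ t<k))) , sym (sumTo-c≡sumTo-a a b a⪯b t<k)
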